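{- Let $c$ be a prime of the form $2^r\cdot 3+1$ ($r$ a positive integer), and let $a,b$ be integers greater than $1$ such that $a,b,c$ are pairwise relatively prime and $e_c(a)=e_c(b)=3$. Let $z,Y,Z$ be positive integers with $z\le Z$, $Y\equiv 4\pmod 6$, $a+b=c^z$ and $a+b^Y=c^Z$; write $Y=1+3N$ and $e=\nu_c(N)$. Then \[c^z(2b+1)+(Y-1)(b^2+b+1)\equiv 0\pmod{c^{2(z-e)}}.\]
   Context: For a positive integer $M$ and an integer $A$ coprime to $M$, $e_M(A)$ is the least positive integer $e$ such that $A^e\equiv\pm1\pmod M$. $\nu_c(N)$ is the exponent of the prime $c$ in $N$. -}

module Defs where

open import Data.Nat using (ℕ; suc; _+_; _*_; _^_; _≤_; _<_)
open import Data.Nat.Divisibility using (_∣_)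
open import Data.Integer using (ℤ; +_; _-_)
import Data.Integer.Divisibility as ℤD
open import Data.Sum using (_⊎_)
open import Data.Product using (_×_)
open import Relation.Nullary using (¬_)

PowPM1 : ℕ → ℕ → ℕ → Set
PowPM1 M A e = (+ M ℤD.∣ (+ (A ^ e) - + 1)) ⊎ (M ∣ A ^ e + 1)

-- e_M(A) = e : e is the least positive integer with A^e ≡ ±1 (mod M)
IsEOrder : ℕ → ℕ → ℕ → Set
IsEOrder M A e = (1 ≤ e) × PowPM1 M A e × (∀ f → 1 ≤ f → f < e → ¬ PowPM1 M A f)

IsValuation : ℕ → ℕ → ℕ → Set
IsValuation c N e = (c ^ e ∣ N) × ¬ (c ^ suc e ∣ N)

{-# OPTIONS --safe #-}
module Submission where

-- Write b³ = 1 + t with t = (b - 1) Φ₃(b).  If b³ ≡ -1 (mod c), then b^Y ≡ -b because N is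
-- odd, and subtracting a + b = c^z from a + b^Y = c^Z modulo c gives c ∣ 2b: impossible.
-- If b³ ≡ 1, the two equations give b ((1 + t)^N - 1) = c^Z - c^z, so c^z ∣ (1 + t)^N - 1.
-- The upper half of the lifting-the-exponent lemma for the odd prime c,
-- ν_c((1 + t)^N - 1) ≤ ν_c(t) + ν_c(N), yields c^m ∣ t, hence c^m ∣ Φ₃(b), where m = z - e.
-- By size, c^(2m) ≤ Φ₃(b)² < c b⁴ ≤ c^(Z+1), so c^(2m) ∣ c^Z; and b (b - 1) times the target
-- is an integer combination of c^z Φ₃(b), c^Z and t², all divisible by c^(2m).

open import Defs
open import Data.Nat
  using (ℕ; zero; suc; _+_; _*_; _^_; _∸_; _≤_; _<_; _%_; _/_; NonZero; z≤n; s≤s; s≤s⁻¹; _≤?_;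
         nonTrivial⇒≢1)
open import Data.Nat.Properties
open import Data.Nat.DivMod using (m≡m%n+[m/n]*n; m%n<n; [m+kn]%n≡m%n)
open import Data.Nat.Divisibility
open import Data.Nat.Combinatorics using (_C_; nC1≡n; nCk+nC[k+1]≡[n+1]C[k+1])
open import Data.Nat.Primality using (Prime; euclidsLemma; prime⇒nonZero; prime⇒nonTrivial)
open import Data.Nat.Coprimality using (Coprime)
open import Data.Nat.Tactic.RingSolver using (solve-∀)
import Data.Integer.Base as ℤ
open import Data.Integer.Divisibility using () renaming (_∣_ to _∣ℤ_)
open import Data.Product using (∃-syntax; _,_; proj₁; proj₂)
open import Data.Sum using (_⊎_; inj₁; inj₂; [_,_]′)
open import Data.Empty using (⊥-elim)
open import Relation.Nullary using (yes; no; contradiction)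
open import Relation.Binary.PropositionalEquality

^-monoʳ-∣ : ∀ p {m n} → m ≤ n → p ^ m ∣ p ^ n
^-monoʳ-∣ p {m} {n} m≤n =
  subst (λ k → p ^ m ∣ p ^ k) (m+[n∸m]≡n m≤n)
    (subst (p ^ m ∣_) (sym (^-distribˡ-+-* p m (n ∸ m))) (m∣m*n (p ^ (n ∸ m))))

^-cancelʳ-< : ∀ p .{{_ : NonZero p}} {m n} → p ^ m < p ^ n → m < n
^-cancelʳ-< p pᵐ<pⁿ = ≰⇒> (λ n≤m → <⇒≱ pᵐ<pⁿ (^-monoʳ-≤ p n≤m))

m∣m^n : ∀ m {n} → 1 ≤ n → m ∣ m ^ n
m∣m^n m (s≤s _) = m∣m*n _

prime∤1 : ∀ {p} → Prime p → p ∤ 1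
prime∤1 p-prime p∣1 = nonTrivial⇒≢1 {{prime⇒nonTrivial p-prime}} (∣1⇒≡1 p∣1)

prime∤1+p*M : ∀ {p} → Prime p → ∀ M → p ∤ 1 + p * M
prime∤1+p*M {p} p-prime M p∣1+pM =
  prime∤1 p-prime (∣m+n∣m⇒∣n (subst (p ∣_) (+-comm 1 (p * M)) p∣1+pM) (m∣m*n M))

prime-power-divisor : ∀ {p m n} → Prime p → p ∤ m → ∀ j → p ^ j ∣ m * n → p ^ j ∣ n
prime-power-divisor {n = n} _ _ zero _ = 1∣ n
prime-power-divisor {p} {m} {n} p-prime p∤m (suc j) pʲ⁺¹∣mn
  with prime-power-divisor p-prime p∤m j (∣-trans (n∣m*n p) pʲ⁺¹∣mn)
... | divides k refl = *-monoˡ-∣ (p ^ j) p∣k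
  where
  instance _ = m^n≢0 p j {{prime⇒nonZero p-prime}}
  p∣mk : p ∣ m * k
  p∣mk = *-cancelʳ-∣ (p ^ j) (subst (p ^ suc j ∣_) (sym (*-assoc m k (p ^ j))) pʲ⁺¹∣mn)
  p∣k : p ∣ k
  p∣k with euclidsLemma m k p-prime p∣mk
  ... | inj₁ p∣m = contradiction p∣m p∤m
  ... | inj₂ p∣k = p∣k

∣x+1∧∣y+1⇒∣x*x*y+1 : ∀ {d x y} → d ∣ x + 1 → d ∣ y + 1 → d ∣ x * x * y + 1
∣x+1∧∣y+1⇒∣x*x*y+1 {d} {x} {y} d∣x+1 d∣y+1 =
  ∣m+n∣m⇒∣n (subst (d ∣_) (regroup x y) (∣m∣n⇒∣m+n (∣n⇒∣m*n (x * x) d∣y+1) d∣x+1))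
            (∣n⇒∣m*n x d∣x+1)
  where
  regroup : ∀ x y → x * x * (y + 1) + (x + 1) ≡ x * (x + 1) + (x * x * y + 1)
  regroup = solve-∀

∣x+1⇒∣x^[1+2k]+1 : ∀ {d x} → d ∣ x + 1 → ∀ k → d ∣ x ^ (1 + 2 * k) + 1
∣x+1⇒∣x^[1+2k]+1 {d} {x} d∣x+1 zero = subst (λ y → d ∣ y + 1) (sym (*-identityʳ x)) d∣x+1
∣x+1⇒∣x^[1+2k]+1 {d} {x} d∣x+1 (suc k) =
  subst (λ y → d ∣ y + 1) (sym x^[3+2k]≡x*x*x^[1+2k])
    (∣x+1∧∣y+1⇒∣x*x*y+1 d∣x+1 (∣x+1⇒∣x^[1+2k]+1 d∣x+1 k))
  where
  x^[3+2k]≡x*x*x^[1+2k] : x ^ (1 + 2 * suc k) ≡ x * x * x ^ (1 + 2 * k)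
  x^[3+2k]≡x*x*x^[1+2k] = trans (cong (λ i → x ^ suc i) (*-suc 2 k)) (sym (*-assoc x x _))

∣y+1⇒∣2*b : ∀ {d A B b y} → d ∣ A → d ∣ B → A + b * y ≡ B + b → d ∣ y + 1 → d ∣ 2 * b
∣y+1⇒∣2*b {d} {A} {B} {b} {y} d∣A d∣B A+by≡B+b d∣y+1 =
  ∣m+n∣m⇒∣n (subst (d ∣_) A+b[y+1]≡B+2b (∣m∣n⇒∣m+n d∣A (∣n⇒∣m*n b d∣y+1))) d∣B
  where
  open ≡-Reasoning
  distrib : ∀ A b y → A + b * (y + 1) ≡ A + b * y + b
  distrib = solve-∀
  double : ∀ B b → B + b + b ≡ B + 2 * b
  double = solve-∀
  A+b[y+1]≡B+2b : A + b * (y + 1) ≡ B + 2 * b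
  A+b[y+1]≡B+2b = begin
    A + b * (y + 1)  ≡⟨ distrib A b y ⟩
    A + b * y + b    ≡⟨ cong (_+ b) A+by≡B+b ⟩
    B + b + b        ≡⟨ double B b ⟩
    B + 2 * b        ∎

prime∤x+1 : ∀ {p b x A B N k} → Prime p → 2 < p → p ∤ b → p ∣ A → p ∣ B → N ≡ 1 + 2 * k →
            A + b * x ^ N ≡ B + b → p ∤ x + 1
prime∤x+1 {b = b} {k = k} p-prime 2<p p∤b p∣A p∣B refl A+bxᴺ≡B+b p∣x+1
  with euclidsLemma 2 b p-prime (∣y+1⇒∣2*b p∣A p∣B A+bxᴺ≡B+b (∣x+1⇒∣x^[1+2k]+1 p∣x+1 k))
... | inj₁ p∣2 = <⇒≱ 2<p (∣⇒≤ p∣2)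
... | inj₂ p∣b = p∤b p∣b

binomial-mod-t² : ∀ t n → ∃[ G ] (1 + t) ^ n ≡ 1 + t * (n + t * G)
binomial-mod-t² t zero = 0 , base t
  where
  base : ∀ t → 1 ≡ 1 + t * (0 + t * 0)
  base = solve-∀
binomial-mod-t² t (suc n) with binomial-mod-t² t n
... | G , eq = n + G + t * G , trans (cong ((1 + t) *_) eq) (step t n G)
  where
  step : ∀ t n G → (1 + t) * (1 + t * (n + t * G)) ≡ 1 + t * (suc n + t * (n + G + t * G))
  step = solve-∀

suc[n]C2 : ∀ n → suc n C 2 ≡ n + n C 2
suc[n]C2 n = trans (sym (nCk+nC[k+1]≡[n+1]C[k+1] n 1)) (cong (_+ n C 2) (nC1≡n n))

binomial-mod-t³ : ∀ t n → ∃[ W ] (1 + t) ^ n ≡ 1 + n * t + (n C 2) * (t * t) + t * t * t * W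
binomial-mod-t³ t zero = 0 , base t
  where
  base : ∀ t → 1 ≡ 1 + 0 * t + 0 * (t * t) + t * t * t * 0
  base = solve-∀
binomial-mod-t³ t (suc n) with binomial-mod-t³ t n
... | W , eq = W′ , (begin
  (1 + t) ^ suc n
    ≡⟨ cong ((1 + t) *_) eq ⟩
  (1 + t) * (1 + n * t + (n C 2) * (t * t) + t * t * t * W)
    ≡⟨ step t n (n C 2) W ⟩
  1 + suc n * t + (n + n C 2) * (t * t) + t * t * t * W′
    ≡⟨ cong (λ T → 1 + suc n * t + T * (t * t) + t * t * t * W′) (sym (suc[n]C2 n)) ⟩
  1 + suc n * t + (suc n C 2) * (t * t) + t * t * t * W′
    ∎)
  where
  open ≡-Reasoning
  W′ = n C 2 + W + t * W
  step : ∀ t n T W → (1 + t) * (1 + n * t + T * (t * t) + t * t * t * W)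
                   ≡ 1 + suc n * t + (n + T) * (t * t) + t * t * t * (T + W + t * W)
  step = solve-∀

[1+2h]C2≡[1+2h]*h : ∀ h → (1 + 2 * h) C 2 ≡ (1 + 2 * h) * h
[1+2h]C2≡[1+2h]*h zero = refl
[1+2h]C2≡[1+2h]*h (suc h) = begin
  (1 + 2 * suc h) C 2      ≡⟨ cong (λ i → suc i C 2) (*-suc 2 h) ⟩
  suc (suc n) C 2          ≡⟨ suc[n]C2 (suc n) ⟩
  suc n + suc n C 2        ≡⟨ cong (suc n +_) (suc[n]C2 n) ⟩
  suc n + (n + n C 2)      ≡⟨ cong (λ T → suc n + (n + T)) ([1+2h]C2≡[1+2h]*h h) ⟩
  suc n + (n + n * h)      ≡⟨ expand h ⟩
  (1 + 2 * suc h) * suc h  ∎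
  where
  open ≡-Reasoning
  n = 1 + 2 * h
  expand : ∀ h → suc (1 + 2 * h) + ((1 + 2 * h) + (1 + 2 * h) * h) ≡ (1 + 2 * suc h) * suc h
  expand = solve-∀

isValuation-*p : ∀ {p n e} .{{_ : NonZero p}} → IsValuation p (n * p) (suc e) → IsValuation p n e
isValuation-*p {p} {n} {e} (pᵉ⁺¹∣np , pᵉ⁺²∤np) =
  *-cancelʳ-∣ p (subst (_∣ n * p) (*-comm p (p ^ e)) pᵉ⁺¹∣np) ,
  λ pᵉ⁺¹∣n → pᵉ⁺²∤np (subst (_∣ n * p) (*-comm (p ^ suc e) p) (*-monoˡ-∣ p pᵉ⁺¹∣n))

module _ {p h : ℕ} (p-prime : Prime p) (p≡1+2h : p ≡ 1 + 2 * h) where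

  private instance
    p≢0 : NonZero p
    p≢0 = prime⇒nonZero p-prime

  [1+t]^p≡1+p*t*[1+p*M] : ∀ {t} → p ∣ t → ∃[ M ] (1 + t) ^ p ≡ 1 + p * t * (1 + p * M)
  [1+t]^p≡1+p*t*[1+p*M] {t} (divides s refl) with binomial-mod-t³ t p
  ... | W , eq = h * s + s * s * W , (begin
    (1 + t) ^ p                                    ≡⟨ eq ⟩
    1 + p * t + (p C 2) * (t * t) + t * t * t * W  ≡⟨ cong (λ T → 1 + p * t + T * (t * t) + t * t * t * W)
                                                           pC2≡p*h ⟩
    1 + p * t + (p * h) * (t * t) + t * t * t * W  ≡⟨ factor p h s W ⟩
    1 + p * t * (1 + p * (h * s + s * s * W))      ∎)
    where
    open ≡-Reasoning
    pC2≡p*h : p C 2 ≡ p * h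
    pC2≡p*h = subst (λ q → q C 2 ≡ q * h) (sym p≡1+2h) ([1+2h]C2≡[1+2h]*h h)
    factor : ∀ p h s W → let t = s * p in
      1 + p * t + (p * h) * (t * t) + t * t * t * W ≡ 1 + p * t * (1 + p * (h * s + s * s * W))
    factor = solve-∀

  lte-bound : ∀ {N e t t'} → IsValuation p N e → p ∣ t → (1 + t) ^ N ≡ 1 + t' →
              ∀ j → p ^ (j + e) ∣ t' → p ^ j ∣ t
  lte-bound {N} {zero} {t} {t'} (_ , p∤N) p∣t [1+t]ᴺ≡1+t' j pʲ∣t'
    with binomial-mod-t² t N
  ... | G , eq = prime-power-divisor p-prime p∤N+tG j
                   (subst (p ^ j ∣_) t'≡[N+tG]t (subst (λ i → p ^ i ∣ t') (+-identityʳ j) pʲ∣t'))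
    where
    t'≡[N+tG]t : t' ≡ (N + t * G) * t
    t'≡[N+tG]t = trans (suc-injective (trans (sym [1+t]ᴺ≡1+t') eq)) (*-comm t _)
    p∤N+tG : p ∤ N + t * G
    p∤N+tG p∣N+tG = p∤N (subst (_∣ N) (sym (*-identityʳ p))
      (∣m+n∣m⇒∣n (subst (p ∣_) (+-comm N _) p∣N+tG) (∣m⇒∣m*n G p∣t)))
  lte-bound {e = suc e} {t} {t'} νN@(pᵉ⁺¹∣N , _) p∣t [1+t]ᴺ≡1+t' j pʲ⁺ᵉ⁺¹∣t'
    with m*n∣⇒m∣ p (p ^ e) pᵉ⁺¹∣N | [1+t]^p≡1+p*t*[1+p*M] p∣t
  ... | divides n refl | M , [1+t]ᵖ≡1+t₁ =
    prime-power-divisor p-prime (prime∤1+p*M p-prime M) j (*-cancelˡ-∣ p pʲ⁺¹∣p*[[1+pM]*t])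
    where
    t₁ = p * t * (1 + p * M)
    [1+t₁]ⁿ≡1+t' : (1 + t₁) ^ n ≡ 1 + t'
    [1+t₁]ⁿ≡1+t' = begin
      (1 + t₁) ^ n       ≡⟨ cong (_^ n) (sym [1+t]ᵖ≡1+t₁) ⟩
      ((1 + t) ^ p) ^ n  ≡⟨ ^-*-assoc (1 + t) p n ⟩
      (1 + t) ^ (p * n)  ≡⟨ cong ((1 + t) ^_) (*-comm p n) ⟩
      (1 + t) ^ (n * p)  ≡⟨ [1+t]ᴺ≡1+t' ⟩
      1 + t'             ∎
      where open ≡-Reasoning
    pʲ⁺¹∣t₁ : p ^ suc j ∣ t₁
    pʲ⁺¹∣t₁ = lte-bound {n} {e} {t₁} (isValuation-*p {e = e} νN) (∣m⇒∣m*n _ (m∣m*n t))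
                [1+t₁]ⁿ≡1+t' (suc j) (subst (λ i → p ^ i ∣ t') (+-suc j e) pʲ⁺ᵉ⁺¹∣t')
    pʲ⁺¹∣p*[[1+pM]*t] : p ^ suc j ∣ p * ((1 + p * M) * t)
    pʲ⁺¹∣p*[[1+pM]*t] =
      subst (p ^ suc j ∣_) (trans (*-assoc p t _) (cong (p *_) (*-comm t _))) pʲ⁺¹∣t₁

  lte-bound-∸ : ∀ {N e t t'} → IsValuation p N e → p ∣ t → (1 + t) ^ N ≡ 1 + t' →
                ∀ j → p ^ j ∣ t' → p ^ (j ∸ e) ∣ t
  lte-bound-∸ {e = e} {t} {t'} νN p∣t [1+t]ᴺ≡1+t' j pʲ∣t' with e ≤? j
  ... | yes e≤j = lte-bound νN p∣t [1+t]ᴺ≡1+t' (j ∸ e)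
                    (subst (λ i → p ^ i ∣ t') (sym (m∸n+n≡m e≤j)) pʲ∣t')
  ... | no e≰j = subst (λ i → p ^ i ∣ t) (sym (m≤n⇒m∸n≡0 (≰⇒≥ e≰j))) (1∣ t)

Φ₃ : ℕ → ℕ
Φ₃ b = b ^ 2 + b + 1

[1+b]³≡1+b*Φ₃[1+b] : ∀ b → (1 + b) ^ 3 ≡ 1 + b * Φ₃ (1 + b)
[1+b]³≡1+b*Φ₃[1+b] = expand
  where
  expand : ∀ b → let x = 1 + b in x * (x * (x * 1)) ≡ 1 + b * (x * (x * 1) + x + 1)
  expand = solve-∀

Φ₃[2+u]²<4*[2+u]⁴ : ∀ u → Φ₃ (2 + u) * Φ₃ (2 + u) < 4 * (2 + u) ^ 4
Φ₃[2+u]²<4*[2+u]⁴ u = subst (Φ₃ (2 + u) * Φ₃ (2 + u) <_) (sym (expand u)) (s≤s (m≤m+n _ _))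
  where
  expand : ∀ u → let b = 2 + u; q = b * (b * 1) + b + 1 in
    4 * (b * (b * (b * (b * 1))))
      ≡ 1 + (q * q + (3 * (u * u * u * u) + 22 * (u * u * u) + 57 * (u * u) + 58 * u + 14))
  expand = solve-∀

-- When x ^ k ≡ 1 + t, the congruence x^k ≡ 1 (mod M), stated in PowPM1 through ℤ, is
-- definitionally M ∣ t.
PowPM1⇒∣t⊎∣xᵏ+1 : ∀ {M x k t} → x ^ k ≡ 1 + t → PowPM1 M x k → M ∣ t ⊎ M ∣ x ^ k + 1
PowPM1⇒∣t⊎∣xᵏ+1 {M} xᵏ≡1+t (inj₁ M∣xᵏ-1) =
  inj₁ (subst (λ y → ℤ.+ M ∣ℤ (ℤ.+ y ℤ.- ℤ.+ 1)) xᵏ≡1+t M∣xᵏ-1)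
PowPM1⇒∣t⊎∣xᵏ+1 _ (inj₂ M∣xᵏ+1) = inj₂ M∣xᵏ+1

∣t⇒PowPM1 : ∀ {M x k t} → x ^ k ≡ 1 + t → M ∣ t → PowPM1 M x k
∣t⇒PowPM1 {M} xᵏ≡1+t M∣t =
  inj₁ (subst (λ y → ℤ.+ M ∣ℤ (ℤ.+ y ℤ.- ℤ.+ 1)) (sym xᵏ≡1+t) M∣t)

[1+3n]%6≡4⇒n≡1+2[n/2] : ∀ n → (1 + 3 * n) % 6 ≡ 4 → n ≡ 1 + 2 * (n / 2)
[1+3n]%6≡4⇒n≡1+2[n/2] n = odd {n} {k = n / 2} (m%n<n n 2) (m≡m%n+[m/n]*n n 2)
  where
  regroup : ∀ k → 1 + k * 6 ≡ 1 + 3 * (0 + k * 2)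
  regroup = solve-∀
  odd : ∀ {n r k} → r < 2 → n ≡ r + k * 2 → (1 + 3 * n) % 6 ≡ 4 → n ≡ 1 + 2 * k
  odd {r = 0} {k} _ refl [1+3n]%6≡4 =
    contradiction (trans (sym ([m+kn]%n≡m%n 1 k 6)) (trans (cong (_% 6) (regroup k)) [1+3n]%6≡4)) λ ()
  odd {r = 1} {k} _ refl _ = cong suc (*-comm k 2)
  odd {r = suc (suc _)} (s≤s (s≤s ())) _ _

X+b*[b³]ᴺ≡Y+b : ∀ {a b N X Y} → a + b ≡ X → a + b ^ (1 + 3 * N) ≡ Y → X + b * (b ^ 3) ^ N ≡ Y + b
X+b*[b³]ᴺ≡Y+b {a} {b} {N} {X} {Y} a+b≡X a+b¹⁺³ᴺ≡Y = begin
  X + b * (b ^ 3) ^ N      ≡⟨ cong₂ _+_ (sym a+b≡X) (cong (b *_) (^-*-assoc b 3 N)) ⟩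
  a + b + b * b ^ (3 * N)  ≡⟨ swap a b (b * b ^ (3 * N)) ⟩
  a + b ^ (1 + 3 * N) + b  ≡⟨ cong (_+ b) a+b¹⁺³ᴺ≡Y ⟩
  Y + b                    ∎
  where
  open ≡-Reasoning
  swap : ∀ x y w → x + y + w ≡ x + w + y
  swap = solve-∀

b⁴≤a+b^[1+3N] : ∀ a b {N} .{{_ : NonZero b}} → 1 ≤ N → b ^ 4 ≤ a + b ^ (1 + 3 * N)
b⁴≤a+b^[1+3N] a b 1≤N = ≤-trans (^-monoʳ-≤ b (s≤s (*-monoʳ-≤ 3 1≤N))) (m≤n+m _ a)

2^[1+r]*3+1≡1+2*[2^r*3] : ∀ r → 2 ^ suc r * 3 + 1 ≡ 1 + 2 * (2 ^ r * 3)
2^[1+r]*3+1≡1+2*[2^r*3] r = regroup (2 ^ r)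
  where
  regroup : ∀ x → 2 * x * 3 + 1 ≡ 1 + 2 * (x * 3)
  regroup = solve-∀

module Case-b³≡1
  {c h u z Z N e : ℕ} (c-prime : Prime c) (c≡1+2h : c ≡ 1 + 2 * h) (4≤c : 4 ≤ c)
  (c∤b : c ∤ 2 + u) (c∤b-1 : c ∤ 1 + u) (c∣b³-1 : c ∣ (1 + u) * Φ₃ (2 + u))
  (νN : IsValuation c N e) (z≤Z : z ≤ Z) (b⁴≤cᶻ : (2 + u) ^ 4 ≤ c ^ Z)
  (cᶻ+b[b³]ᴺ≡cᶻ+b : c ^ z + (2 + u) * ((2 + u) ^ 3) ^ N ≡ c ^ Z + (2 + u))
  where

  private instance
    c≢0 : NonZero c
    c≢0 = prime⇒nonZero c-prime

  b : ℕ
  b = 2 + u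

  q : ℕ
  q = Φ₃ b

  t : ℕ
  t = (1 + u) * q

  m : ℕ
  m = z ∸ e

  G : ℕ
  G = proj₁ (binomial-mod-t² t N)

  V : ℕ
  V = N + t * G

  [1+t]ᴺ≡1+tV : (1 + t) ^ N ≡ 1 + t * V
  [1+t]ᴺ≡1+tV = proj₂ (binomial-mod-t² t N)

  cᶻ+b*tV≡cᶻ : c ^ z + b * (t * V) ≡ c ^ Z
  cᶻ+b*tV≡cᶻ = +-cancelʳ-≡ b _ _ (begin
    c ^ z + b * (t * V) + b  ≡⟨ regroup (c ^ z) b (t * V) ⟩
    c ^ z + b * (1 + t * V)  ≡⟨ cong (λ x → c ^ z + b * x) (sym [1+t]ᴺ≡1+tV) ⟩
    c ^ z + b * (1 + t) ^ N  ≡⟨ cong (λ x → c ^ z + b * x ^ N) (sym ([1+b]³≡1+b*Φ₃[1+b] (1 + u))) ⟩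
    c ^ z + b * (b ^ 3) ^ N  ≡⟨ cᶻ+b[b³]ᴺ≡cᶻ+b ⟩
    c ^ Z + b                ∎)
    where
    open ≡-Reasoning
    regroup : ∀ C b x → C + b * x + b ≡ C + b * (1 + x)
    regroup = solve-∀

  cᶻ∣tV : c ^ z ∣ t * V
  cᶻ∣tV = prime-power-divisor c-prime c∤b z
    (∣m+n∣m⇒∣n (subst (c ^ z ∣_) (sym cᶻ+b*tV≡cᶻ) (^-monoʳ-∣ c z≤Z)) ∣-refl)

  cᵐ∣t : c ^ m ∣ t
  cᵐ∣t = lte-bound-∸ {h = h} c-prime c≡1+2h {e = e} νN c∣b³-1 [1+t]ᴺ≡1+tV z cᶻ∣tV

  cᵐ∣q : c ^ m ∣ q
  cᵐ∣q = prime-power-divisor c-prime c∤b-1 m cᵐ∣t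

  c^[2m]≡cᵐ*cᵐ : c ^ (2 * m) ≡ c ^ m * c ^ m
  c^[2m]≡cᵐ*cᵐ = trans (cong (λ i → c ^ (m + i)) (+-identityʳ m)) (^-distribˡ-+-* c m m)

  2m≤Z : 2 * m ≤ Z
  2m≤Z = s≤s⁻¹ (^-cancelʳ-< c (begin-strict
    c ^ (2 * m)    ≡⟨ c^[2m]≡cᵐ*cᵐ ⟩
    c ^ m * c ^ m  ≤⟨ *-mono-≤ cᵐ≤q cᵐ≤q ⟩
    q * q          <⟨ Φ₃[2+u]²<4*[2+u]⁴ u ⟩
    4 * b ^ 4      ≤⟨ *-mono-≤ 4≤c b⁴≤cᶻ ⟩
    c * c ^ Z      ∎))
    where
    open ≤-Reasoning
    cᵐ≤q : c ^ m ≤ q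
    cᵐ≤q = ∣⇒≤ cᵐ∣q

  target : ℕ
  target = c ^ z * (2 * b + 1) + 3 * N * q

  key-identity : t * t * (3 * b * G) + b * ((1 + u) * target) ≡ c ^ z * ((2 * u + 1) * q) + 3 * c ^ Z
  key-identity = begin
    t * t * (3 * b * G) + b * ((1 + u) * target)           ≡⟨ expand u N G (c ^ z) ⟩
    c ^ z * ((2 * u + 1) * q) + 3 * (c ^ z + b * (t * V))  ≡⟨ cong (λ x → c ^ z * ((2 * u + 1) * q) + 3 * x)
                                                                   cᶻ+b*tV≡cᶻ ⟩
    c ^ z * ((2 * u + 1) * q) + 3 * c ^ Z                  ∎
    where
    open ≡-Reasoning
    expand : ∀ u N G C → let b = 2 + u; q = b * (b * 1) + b + 1; t = (1 + u) * q in
      t * t * (3 * b * G) + b * ((1 + u) * (C * (2 * b + 1) + 3 * N * q))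
        ≡ C * ((2 * u + 1) * q) + 3 * (C + b * (t * (N + t * G)))
    expand = solve-∀

  c^[2m]∣target : c ^ (2 * m) ∣ target
  c^[2m]∣target =
    prime-power-divisor c-prime c∤b-1 (2 * m) (prime-power-divisor c-prime c∤b (2 * m)
      (∣m+n∣m⇒∣n (subst (c ^ (2 * m) ∣_) (sym key-identity) c^[2m]∣rhs)
                 (∣m⇒∣m*n (3 * b * G) c^[2m]∣t²)))
    where
    c^[2m]∣cᶻq : c ^ (2 * m) ∣ c ^ z * ((2 * u + 1) * q)
    c^[2m]∣cᶻq = subst (_∣ c ^ z * ((2 * u + 1) * q)) (sym c^[2m]≡cᵐ*cᵐ)
                   (*-pres-∣ (^-monoʳ-∣ c (m∸n≤m z e)) (∣n⇒∣m*n (2 * u + 1) cᵐ∣q))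
    c^[2m]∣rhs : c ^ (2 * m) ∣ c ^ z * ((2 * u + 1) * q) + 3 * c ^ Z
    c^[2m]∣rhs = ∣m∣n⇒∣m+n c^[2m]∣cᶻq (∣n⇒∣m*n 3 (^-monoʳ-∣ c 2m≤Z))
    c^[2m]∣t² : c ^ (2 * m) ∣ t * t
    c^[2m]∣t² = subst (_∣ t * t) (sym c^[2m]≡cᵐ*cᵐ) (*-pres-∣ cᵐ∣t cᵐ∣t)

lemma5p11 : (c r a b z Y Z N e : ℕ) →
    Prime c → 1 ≤ r → c ≡ 2 ^ r * 3 + 1 →
    1 < a → 1 < b →
    Coprime a b → Coprime a c → Coprime b c →
    IsEOrder c a 3 → IsEOrder c b 3 →
    1 ≤ z → 1 ≤ Y → 1 ≤ Z → z ≤ Z →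
    Y % 6 ≡ 4 →
    a + b ≡ c ^ z → a + b ^ Y ≡ c ^ Z →
    Y ≡ 1 + 3 * N → IsValuation c N e →
    c ^ (2 * (z ∸ e)) ∣ c ^ z * (2 * b + 1) + (Y ∸ 1) * (b ^ 2 + b + 1)
lemma5p11 c r a b z Y Z N e c-prime (s≤s (z≤n {r'})) c≡2ʳ3+1 _ (s≤s (s≤s (z≤n {u}))) _ _ b⊥c _
          (_ , b³≡±1 , minimal) 1≤z _ 1≤Z z≤Z [1+3N]%6≡4 a+b≡cᶻ a+bʸ≡cᶻ refl νN =
  [ (λ c∣b³-1 → Case-b³≡1.c^[2m]∣target {h = h} {e = e} c-prime c≡1+2h 4≤c c∤b c∤b-1 c∣b³-1
                  νN z≤Z b⁴≤cᶻ cᶻ+b[b³]ᴺ≡cᶻ+b)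
  , (λ c∣b³+1 → ⊥-elim (prime∤x+1 {N = N} {k = N / 2} c-prime (≤-trans (s≤s (s≤s (s≤s z≤n))) 4≤c)
                  c∤b (m∣m^n c 1≤z) (m∣m^n c 1≤Z) N≡1+2k cᶻ+b[b³]ᴺ≡cᶻ+b c∣b³+1))
  ]′ (PowPM1⇒∣t⊎∣xᵏ+1 {x = b} {k = 3} ([1+b]³≡1+b*Φ₃[1+b] (1 + u)) b³≡±1)
  where
  h : ℕ
  h = 2 ^ r' * 3

  c≡1+2h : c ≡ 1 + 2 * h
  c≡1+2h = trans c≡2ʳ3+1 (2^[1+r]*3+1≡1+2*[2^r*3] r')

  4≤c : 4 ≤ c
  4≤c = subst (4 ≤_) (sym c≡1+2h) (s≤s (≤-trans (*-monoˡ-≤ 3 (m^n>0 2 r')) (m≤n*m h 2)))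

  c∤b : c ∤ b
  c∤b c∣b = <⇒≢ (≤-trans (s≤s (s≤s z≤n)) 4≤c) (sym (b⊥c (c∣b , ∣-refl)))

  c∤b-1 : c ∤ 1 + u
  c∤b-1 c∣b-1 = minimal 1 ≤-refl (s≤s (s≤s z≤n)) (∣t⇒PowPM1 {x = b} {k = 1} (*-identityʳ b) c∣b-1)

  N≡1+2k : N ≡ 1 + 2 * (N / 2)
  N≡1+2k = [1+3n]%6≡4⇒n≡1+2[n/2] N [1+3N]%6≡4

  cᶻ+b[b³]ᴺ≡cᶻ+b : c ^ z + b * (b ^ 3) ^ N ≡ c ^ Z + b
  cᶻ+b[b³]ᴺ≡cᶻ+b = X+b*[b³]ᴺ≡Y+b {N = N} a+b≡cᶻ a+bʸ≡cᶻ

  b⁴≤cᶻ : b ^ 4 ≤ c ^ Z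
  b⁴≤cᶻ = subst (b ^ 4 ≤_) a+bʸ≡cᶻ (b⁴≤a+b^[1+3N] a b (subst (1 ≤_) (sym N≡1+2k) (s≤s z≤n)))
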